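{- Let $G=T\circ\mathcal{P}$ be a general corona of a tree $T$ and let $(v,1)$ be an external vertex of $G$. If two distinct neighbors of $(v,1)$ in $G$ are contracted into a single vertex, then the resulting graph is also (isomorphic to) a general corona of a tree.
   Context: For a graph $T$, a vertex neighborhood partition is a family $\mathcal{P}=\{\mathcal{P}(v): v\in V(T)\}$ where each $\mathcal{P}(v)$ is a partition of $N_T(v)$ into nonempty parts. The general corona $T\circ\mathcal{P}$ has vertex set $\{(v,1): v\in V(T)\}\cup\bigcup_{v\in V(T)}\{(v,A): A\in\mathcal{P}(v)\}$ and edge set $\bigcup_{v}\{(v,1)(v,A): A\in\mathcal{P}(v)\}\cup\bigcup_{uv\in E(T)}\{(v,A)(u,B): u\in A,\ v\in B\}$. The vertices $(v,1)$ are called external. Contracting two vertices $x,y$ means replacing them by a single new vertex adjacent to every vertex other than $x,y$ that was adjacent to $x$ or to $y$. -}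

module Defs where

open import Data.Nat using (ℕ; _≤_)
open import Data.Fin using (Fin)
import Data.Fin.Properties as FinP
open import Data.Bool using (Bool; false; T)
open import Data.List using (List; []; _∷_; _++_; [_]; length)
open import Data.List.Relation.Unary.Linked using (Linked)
open import Data.List.Relation.Unary.Unique.Propositional using (Unique)
open import Data.Product using (Σ; ∃-syntax; _×_; _,_; proj₁)
import Data.Product.Properties as ProdP
open import Data.Sum using (_⊎_; inj₁; inj₂)
import Data.Sum.Properties as SumP
open import Data.Unit using (⊤)
open import Data.Empty using (⊥)
open import Relation.Nullary using (¬_)
open import Relation.Nullary.Decidable using (False)
open import Relation.Binary.PropositionalEquality using (_≡_)
open import Relation.Binary.Definitions using (DecidableEquality)
open import Function.Bundles using (_↔_; _⇔_; Inverse)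

record SimpleGraphOn (n : ℕ) : Set where
  field
    adj        : Fin n → Fin n → Bool
    adj-sym    : ∀ u v → adj u v ≡ adj v u
    adj-irrefl : ∀ v → adj v v ≡ false

  Adj : Fin n → Fin n → Set
  Adj u v = T (adj u v)

open SimpleGraphOn public using (Adj)

data Walk {n : ℕ} (G : SimpleGraphOn n) : Fin n → Fin n → Set where
  nil  : ∀ {u} → Walk G u u
  cons : ∀ {u v w} → Adj G u v → Walk G v w → Walk G u w

Connected : ∀ {n} → SimpleGraphOn n → Set
Connected G = ∀ u v → Walk G u v

IsCycle : ∀ {n} → SimpleGraphOn n → Fin n → List (Fin n) → Set
IsCycle G x l = (2 ≤ length l) × Unique (x ∷ l) × Linked (Adj G) (x ∷ l ++ [ x ])

Acyclic : ∀ {n} → SimpleGraphOn n → Set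
Acyclic G = ∀ x l → ¬ IsCycle G x l

IsTree : ∀ {n} → SimpleGraphOn n → Set
IsTree G = Connected G × Acyclic G

-- Vertex neighbourhood partitions: P(v) has parts indexed by Fin (nparts v);
-- part i of P(v) is { u ∈ N(v) : label v u _ ≡ i }, required nonempty.

record NbhdPartition {n : ℕ} (G : SimpleGraphOn n) : Set where
  field
    nparts   : Fin n → ℕ
    label    : (v u : Fin n) → Adj G v u → Fin (nparts v)
    nonempty : ∀ v (i : Fin (nparts v)) → ∃[ u ] Σ (Adj G v u) (λ p → label v u p ≡ i)

record Graph : Set₁ where
  field
    V : Set
    E : V → V → Set

record _≅_ (G H : Graph) : Set where
  field
    bij  : Graph.V G ↔ Graph.V H
    pres : ∀ a b → Graph.E G a b ⇔ Graph.E H (Inverse.to bij a) (Inverse.to bij b)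

-- General corona T ∘ P.  inj₁ v = (v,1); inj₂ (v , i) = (v, A_i) with A_i ∈ P(v)

module _ {n : ℕ} (G : SimpleGraphOn n) (P : NbhdPartition G) where
  open NbhdPartition P

  CoronaV : Set
  CoronaV = Fin n ⊎ Σ (Fin n) (λ v → Fin (nparts v))

  CoronaE : CoronaV → CoronaV → Set
  CoronaE (inj₁ v) (inj₁ u) = ⊥
  CoronaE (inj₁ v) (inj₂ (w , i)) = v ≡ w
  CoronaE (inj₂ (w , i)) (inj₁ v) = w ≡ v
  CoronaE (inj₂ (v , i)) (inj₂ (u , j)) =
    Σ (Adj G v u) λ p → Σ (Adj G u v) λ q → (label v u p ≡ i) × (label u v q ≡ j)

  corona : Graph
  corona = record { V = CoronaV ; E = CoronaE }

  corona-dec : DecidableEquality CoronaV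
  corona-dec = SumP.≡-dec FinP._≟_ (ProdP.≡-dec FinP._≟_ FinP._≟_)

module _ (G : Graph) (eq : DecidableEquality (Graph.V G)) (x y : Graph.V G) where
  open Graph G

  ContrV : Set
  ContrV = Σ V (λ w → False (eq w x) × False (eq w y)) ⊎ ⊤

  ContrE : ContrV → ContrV → Set
  ContrE (inj₁ a) (inj₁ b) = E (proj₁ a) (proj₁ b)
  ContrE (inj₁ a) (inj₂ _) = E (proj₁ a) x ⊎ E (proj₁ a) y
  ContrE (inj₂ _) (inj₁ b) = E x (proj₁ b) ⊎ E y (proj₁ b)
  ContrE (inj₂ _) (inj₂ _) = ⊥

  contract : Graph
  contract = record { V = ContrV ; E = ContrE }

-- Contracting the two vertices (v,A) and (v,B) adjacent to (v,1) yields the general corona of the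
-- same tree in which the parts A and B of P(v) are replaced by their union. Indeed, the corona of
-- a coarsened partition is the image of the original corona under the map collapsing the merged
-- parts, and contracting x and y is the same as taking the image under any map which identifies
-- exactly x with y, provided x and y are not adjacent.
module Submission where

open import Defs
open import Data.Nat using (ℕ; suc; pred)
open import Data.Fin using (Fin; punchIn; punchOut)
open import Data.Fin.Properties using (_≟_; punchOut-cong; punchOut-injective; punchOut-punchIn; punchInᵢ≢i)
open import Data.Product using (Σ; ∃-syntax; _×_; _,_; proj₁; proj₂)
open import Data.Sum using (_⊎_; inj₁; inj₂; [_,_]; map)
open import Data.Unit using (tt)
open import Data.Empty using (⊥-elim)
open import Data.Bool using (T)
open import Data.Bool.Properties using (T-irrelevant)
open import Function using (_∘_; id)
open import Function.Bundles using (_⇔_; mk⇔; mk↔ₛ′)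
open import Relation.Nullary using (Dec; yes; no; ¬_)
open import Relation.Nullary.Decidable using (False; fromWitnessFalse; toWitnessFalse)
open import Relation.Binary.Definitions using (DecidableEquality)
open import Relation.Binary.PropositionalEquality using (_≡_; _≢_; refl; sym; trans; cong; subst; subst₂)

_∈[_,_] : {A : Set} → A → A → A → Set
a ∈[ x , y ] = a ≡ x ⊎ a ≡ y

Adj-irreflexive : ∀ {n} (G : SimpleGraphOn n) {v} → ¬ Adj G v v
Adj-irreflexive G {v} = subst T (SimpleGraphOn.adj-irrefl G v)

-- j is sent to the image of i, and the gap left by j is closed with punchOut.
mergeFin : ∀ {N} (i j : Fin N) → i ≢ j → Fin N → Fin (pred N)
mergeFin {suc _} i j i≢j t with t ≟ j
... | yes _   = punchOut (i≢j ∘ sym)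
... | no t≢j = punchOut (t≢j ∘ sym)

mergeFin-identifies : ∀ {N} {i j : Fin N} (i≢j : i ≢ j) → mergeFin i j i≢j i ≡ mergeFin i j i≢j j
mergeFin-identifies {suc _} {i} {j} i≢j with i ≟ j | j ≟ j
... | yes i≡j | _      = ⊥-elim (i≢j i≡j)
... | no _    | yes _  = punchOut-cong j refl
... | no _    | no j≢j = ⊥-elim (j≢j refl)

mergeFin-injective : ∀ {N} {i j s t : Fin N} (i≢j : i ≢ j) → s ≢ j → t ≢ j
                   → mergeFin i j i≢j s ≡ mergeFin i j i≢j t → s ≡ t
mergeFin-injective {suc _} {i} {j} {s} {t} i≢j s≢j t≢j e with s ≟ j | t ≟ j
... | yes s≡j | _       = ⊥-elim (s≢j s≡j)
... | no _    | yes t≡j = ⊥-elim (t≢j t≡j)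
... | no _    | no _    = punchOut-injective (s≢j ∘ sym) (t≢j ∘ sym) e

mergeFin-surjective : ∀ {N} {i j : Fin N} (i≢j : i ≢ j) s → ∃[ t ] mergeFin i j i≢j t ≡ s
mergeFin-surjective {suc _} {i} {j} i≢j s = punchIn j s , merge-punchIn
  where
  merge-punchIn : mergeFin i j i≢j (punchIn j s) ≡ s
  merge-punchIn with punchIn j s ≟ j
  ... | yes e = ⊥-elim (punchInᵢ≢i j s e)
  ... | no _  = trans (punchOut-cong j refl) (punchOut-punchIn j)

mergeFin-≡-image-of-j : ∀ {N} {i j r : Fin N} (i≢j : i ≢ j) → r ≢ j
                      → mergeFin i j i≢j r ≡ mergeFin i j i≢j j → r ≡ i
mergeFin-≡-image-of-j i≢j r≢j e = mergeFin-injective i≢j r≢j i≢j (trans e (sym (mergeFin-identifies i≢j)))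

mergeFin-fibres : ∀ {N} {i j s t : Fin N} (i≢j : i ≢ j) → mergeFin i j i≢j s ≡ mergeFin i j i≢j t
                → s ≡ t ⊎ (s ∈[ i , j ] × t ∈[ i , j ])
mergeFin-fibres {j = j} {s} {t} i≢j e with s ≟ j | t ≟ j
... | yes s≡j  | yes t≡j  = inj₁ (trans s≡j (sym t≡j))
... | yes refl | no t≢j   = inj₂ (inj₂ refl , inj₁ (mergeFin-≡-image-of-j i≢j t≢j (sym e)))
... | no s≢j   | yes refl = inj₂ (inj₁ (mergeFin-≡-image-of-j i≢j s≢j e) , inj₂ refl)
... | no s≢j   | no t≢j   = inj₁ (mergeFin-injective i≢j s≢j t≢j e)

module _ {G H : Graph} (_≟G_ : DecidableEquality (Graph.V G)) {x y : Graph.V G}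
  (φ : Graph.V G → Graph.V H)
  (φ-surjective : ∀ h → ∃[ a ] φ a ≡ h)
  (φ-fibres : ∀ {a b} → φ a ≡ φ b → a ≡ b ⊎ (a ∈[ x , y ] × b ∈[ x , y ]))
  (φx≡φy : φ x ≡ φ y)
  (φ-homomorphism : ∀ {a b} → Graph.E G a b → Graph.E H (φ a) (φ b))
  (φ-lifts : ∀ {a b} → Graph.E H (φ a) (φ b)
           → ∃[ a′ ] ∃[ b′ ] φ a′ ≡ φ a × φ b′ ≡ φ b × Graph.E G a′ b′)
  (x,y-nonadjacent : ∀ {a b} → a ∈[ x , y ] → b ∈[ x , y ] → ¬ Graph.E G a b)
  where
  open Graph

  private
    G/xy = contract G _≟G_ x y

    Unmerged : V G → Set
    Unmerged a = False (a ≟G x) × False (a ≟G y)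

    unmerged-∉ : ∀ {a} → Unmerged a → ¬ a ∈[ x , y ]
    unmerged-∉ (a≢x , a≢y) = [ toWitnessFalse a≢x , toWitnessFalse a≢y ]

    fibre-unmerged : ∀ {a b} → Unmerged a → φ b ≡ φ a → b ≡ a
    fibre-unmerged u e = [ id , ⊥-elim ∘ unmerged-∉ u ∘ proj₂ ] (φ-fibres e)

    fibre-merged : ∀ {b} → φ b ≡ φ x → b ∈[ x , y ]
    fibre-merged e = [ inj₁ , proj₁ ] (φ-fibres e)

    E-into-merged : ∀ {a b} → b ∈[ x , y ] → E G a b → E G a x ⊎ E G a y
    E-into-merged (inj₁ refl) = inj₁
    E-into-merged (inj₂ refl) = inj₂

    E-from-merged : ∀ {a b} → a ∈[ x , y ] → E G a b → E G x b ⊎ E G y b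
    E-from-merged (inj₁ refl) = inj₁
    E-from-merged (inj₂ refl) = inj₂

    toImage : V G/xy → V H
    toImage (inj₁ (a , _)) = φ a
    toImage (inj₂ _)       = φ x

    classify : V G → V G/xy
    classify a with a ≟G x | a ≟G y
    ... | yes _   | _       = inj₂ tt
    ... | no _    | yes _   = inj₂ tt
    ... | no a≢x | no a≢y = inj₁ (a , fromWitnessFalse a≢x , fromWitnessFalse a≢y)

    toImage-classify : ∀ a → toImage (classify a) ≡ φ a
    toImage-classify a with a ≟G x | a ≟G y
    ... | yes refl | _        = refl
    ... | no _     | yes refl = φx≡φy
    ... | no _     | no _     = refl

    unmerged-irrelevant : ∀ {a b} (u : Unmerged a) (w : Unmerged b) → a ≡ b
                        → _≡_ {A = V G/xy} (inj₁ (a , u)) (inj₁ (b , w))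
    unmerged-irrelevant (p , q) (p′ , q′) refl rewrite T-irrelevant p p′ | T-irrelevant q q′ = refl

    toImage-injective : ∀ {c d} → toImage c ≡ toImage d → c ≡ d
    toImage-injective {inj₁ (a , u)} {inj₁ (b , w)} e = unmerged-irrelevant u w (fibre-unmerged w e)
    toImage-injective {inj₁ (a , u)} {inj₂ _}       e = ⊥-elim (unmerged-∉ u (fibre-merged e))
    toImage-injective {inj₂ _}       {inj₁ (b , w)} e = ⊥-elim (unmerged-∉ w (fibre-merged (sym e)))
    toImage-injective {inj₂ _}       {inj₂ _}       _ = refl

    fromImage : V H → V G/xy
    fromImage h = classify (proj₁ (φ-surjective h))

    toImage-fromImage : ∀ h → toImage (fromImage h) ≡ h
    toImage-fromImage h = trans (toImage-classify _) (proj₂ (φ-surjective h))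

    fromImage-toImage : ∀ c → fromImage (toImage c) ≡ c
    fromImage-toImage c = toImage-injective (toImage-fromImage (toImage c))

    toImage-preserves-E : ∀ c d → E G/xy c d ⇔ E H (toImage c) (toImage d)
    toImage-preserves-E (inj₁ (a , u)) (inj₁ (b , w)) = mk⇔ φ-homomorphism λ e →
      let (a′ , b′ , ea , eb , e′) = φ-lifts e
      in subst₂ (E G) (fibre-unmerged u ea) (fibre-unmerged w eb) e′
    toImage-preserves-E (inj₁ (a , u)) (inj₂ _) =
      mk⇔ [ φ-homomorphism , subst (E H (φ a)) (sym φx≡φy) ∘ φ-homomorphism ] λ e →
      let (a′ , b′ , ea , eb , e′) = φ-lifts e
      in E-into-merged (fibre-merged eb) (subst (λ c → E G c b′) (fibre-unmerged u ea) e′)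
    toImage-preserves-E (inj₂ _) (inj₁ (b , w)) =
      mk⇔ [ φ-homomorphism , subst (λ h → E H h (φ b)) (sym φx≡φy) ∘ φ-homomorphism ] λ e →
      let (a′ , b′ , ea , eb , e′) = φ-lifts e
      in E-from-merged (fibre-merged ea) (subst (E G a′) (fibre-unmerged w eb) e′)
    toImage-preserves-E (inj₂ _) (inj₂ _) = mk⇔ (λ ()) λ e →
      let (a′ , b′ , ea , eb , e′) = φ-lifts e
      in x,y-nonadjacent (fibre-merged ea) (fibre-merged eb) e′

  contract-≅-image : contract G _≟G_ x y ≅ H
  contract-≅-image = record
    { bij  = mk↔ₛ′ toImage fromImage toImage-fromImage fromImage-toImage
    ; pres = toImage-preserves-E
    }

module _ {n} {T : SimpleGraphOn n} {P : NbhdPartition T} where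

  part-vertex-injective : ∀ {u w s t} → _≡_ {A = CoronaV T P} (inj₂ (u , s)) (inj₂ (w , t)) → u ≡ w
  part-vertex-injective refl = refl

  part-index-injective : ∀ {u s t} → _≡_ {A = CoronaV T P} (inj₂ (u , s)) (inj₂ (u , t)) → s ≡ t
  part-index-injective refl = refl

module Coarsening {n} (T : SimpleGraphOn n) (P : NbhdPartition T) (m : Fin n → ℕ)
  (g : ∀ u → Fin (NbhdPartition.nparts P u) → Fin (m u))
  (g-surjective : ∀ u s → ∃[ t ] g u t ≡ s)
  where
  open NbhdPartition P

  coarsening : NbhdPartition T
  coarsening = record
    { nparts   = m
    ; label    = λ u w p → g u (label u w p)
    ; nonempty = λ u s → let (t , gt≡s) = g-surjective u s
                             (w , p , label≡t) = nonempty u t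
                         in w , p , trans (cong (g u) label≡t) gt≡s
    }

  coarsen : CoronaV T P → CoronaV T coarsening
  coarsen (inj₁ u)       = inj₁ u
  coarsen (inj₂ (u , t)) = inj₂ (u , g u t)

  coarsen-surjective : ∀ c → ∃[ a ] coarsen a ≡ c
  coarsen-surjective (inj₁ u)       = inj₁ u , refl
  coarsen-surjective (inj₂ (u , s)) =
    let (t , gt≡s) = g-surjective u s in inj₂ (u , t) , cong (λ r → inj₂ (u , r)) gt≡s

  coarsen-homomorphism : ∀ {a b} → CoronaE T P a b → CoronaE T coarsening (coarsen a) (coarsen b)
  coarsen-homomorphism {inj₁ _}       {inj₂ _}       e = e
  coarsen-homomorphism {inj₂ _}       {inj₁ _}       e = e
  coarsen-homomorphism {inj₂ (u , _)} {inj₂ (w , _)} (p , q , e₁ , e₂) = p , q , cong (g u) e₁ , cong (g w) e₂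

  coarsen-lifts : ∀ {a b} → CoronaE T coarsening (coarsen a) (coarsen b)
                → ∃[ a′ ] ∃[ b′ ] coarsen a′ ≡ coarsen a × coarsen b′ ≡ coarsen b × CoronaE T P a′ b′
  coarsen-lifts {inj₁ _} {inj₂ _} e = _ , _ , refl , refl , e
  coarsen-lifts {inj₂ _} {inj₁ _} e = _ , _ , refl , refl , e
  coarsen-lifts {inj₂ (u , _)} {inj₂ (w , _)} (p , q , e₁ , e₂) =
    inj₂ (u , label u w p) , inj₂ (w , label w u q) ,
    cong (λ r → inj₂ (u , r)) e₁ , cong (λ r → inj₂ (w , r)) e₂ , p , q , refl , refl

module MergeParts {n} (T : SimpleGraphOn n) (P : NbhdPartition T) (v : Fin n)
  {i j : Fin (NbhdPartition.nparts P v)} (i≢j : i ≢ j)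
  where
  open NbhdPartition P

  x y : CoronaV T P
  x = inj₂ (v , i)
  y = inj₂ (v , j)

  -- Indexed by an arbitrary decision of u ≡ v so that lemmas can split on it; the partition
  -- itself uses u ≟ v.
  mergedParts : ∀ u → Dec (u ≡ v) → ℕ
  mergedParts u (yes _) = pred (nparts u)
  mergedParts u (no _)  = nparts u

  mergeParts : ∀ u (d : Dec (u ≡ v)) → Fin (nparts u) → Fin (mergedParts u d)
  mergeParts u (yes refl) = mergeFin i j i≢j
  mergeParts u (no _)     = id

  mergeParts-surjective : ∀ u d s → ∃[ t ] mergeParts u d t ≡ s
  mergeParts-surjective u (yes refl) = mergeFin-surjective i≢j
  mergeParts-surjective u (no _)   s = s , refl

  mergeParts-identifies : ∀ d → mergeParts v d i ≡ mergeParts v d j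
  mergeParts-identifies (yes refl) = mergeFin-identifies i≢j
  mergeParts-identifies (no v≢v)   = ⊥-elim (v≢v refl)

  mergeParts-fibres : ∀ u d {s t} → mergeParts u d s ≡ mergeParts u d t
                    → s ≡ t ⊎ (inj₂ (u , s) ∈[ x , y ] × inj₂ (u , t) ∈[ x , y ])
  mergeParts-fibres u (yes refl) e =
    map id (λ (s∈ , t∈) → part-merged s∈ , part-merged t∈) (mergeFin-fibres i≢j e)
    where
    part-merged : ∀ {s} → s ∈[ i , j ] → inj₂ (v , s) ∈[ x , y ]
    part-merged = map (cong (λ r → inj₂ (v , r))) (cong (λ r → inj₂ (v , r)))
  mergeParts-fibres u (no _) e = inj₁ e

  open Coarsening T P (λ u → mergedParts u (u ≟ v)) (λ u → mergeParts u (u ≟ v))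
                      (λ u → mergeParts-surjective u (u ≟ v))
    public

  coarsen-fibres : ∀ {a b} → coarsen a ≡ coarsen b → a ≡ b ⊎ (a ∈[ x , y ] × b ∈[ x , y ])
  coarsen-fibres {inj₁ _} {inj₁ _} refl = inj₁ refl
  coarsen-fibres {inj₂ (u , s)} {inj₂ (w , t)} e with part-vertex-injective {P = coarsening} e
  ... | refl = map (cong (λ r → inj₂ (u , r))) id
                   (mergeParts-fibres u (u ≟ v) (part-index-injective {P = coarsening} e))

  parts-nonadjacent : ∀ {a b} → a ∈[ x , y ] → b ∈[ x , y ] → ¬ CoronaE T P a b
  parts-nonadjacent (inj₁ refl) (inj₁ refl) (p , _) = Adj-irreflexive T p
  parts-nonadjacent (inj₁ refl) (inj₂ refl) (p , _) = Adj-irreflexive T p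
  parts-nonadjacent (inj₂ refl) (inj₁ refl) (p , _) = Adj-irreflexive T p
  parts-nonadjacent (inj₂ refl) (inj₂ refl) (p , _) = Adj-irreflexive T p

  contract-≅-coarsening : contract (corona T P) (corona-dec T P) x y ≅ corona T coarsening
  contract-≅-coarsening =
    contract-≅-image (corona-dec T P) coarsen coarsen-surjective coarsen-fibres
      (cong (λ r → inj₂ (v , r)) (mergeParts-identifies (v ≟ v)))
      coarsen-homomorphism coarsen-lifts parts-nonadjacent

mainTheorem4 : ∀ {n} (T : SimpleGraphOn n) → IsTree T → (P : NbhdPartition T) → (v : Fin n)
    → (x y : CoronaV T P) → CoronaE T P (inj₁ v) x → CoronaE T P (inj₁ v) y → x ≢ y
    → Σ ℕ λ m → Σ (SimpleGraphOn m) λ T′ → IsTree T′ × Σ (NbhdPartition T′) λ P′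
    → contract (corona T P) (corona-dec T P) x y ≅ corona T′ P′
mainTheorem4 {n} T tree P v (inj₂ (.v , i)) (inj₂ (.v , j)) refl refl x≢y =
  n , T , tree , coarsening , contract-≅-coarsening
  where
  open MergeParts T P v (x≢y ∘ cong (λ r → inj₂ (v , r)))
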